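{- Let $N,P$ be positive integers, $\boldsymbol{a}=(a_{1\cdot},\ldots,a_{N\cdot})$ an integer vector and $\boldsymbol{\phi}_0,\boldsymbol{\phi}_1\in\mathbb{Z}^P$. The number of admixed arrays whose row local ancestry tallies are $\boldsymbol{a}$ and whose ancestry-specific allele dosages are $(\boldsymbol{\phi}_0,\boldsymbol{\phi}_1)$ is $$\left|\mathscr{A}_{12}\right|=\sum_{[\mathbf{s}_1,\mathbf{s}_2]\in\mathscr{S}} |\mathscr{A}(\mathbf{s}_1,\mathbf{s}_2,\boldsymbol{a})|\prod_{p=1}^P\binom{s_{1p}+s_{2p}}{\phi_{p,1}}\binom{2N-(s_{1p}+s_{2p})}{\phi_{p,0}}.$$
   Context: An admixed array with parameters $N,P$ is a pair $[\mathbf{A},\mathbf{X}]$ of $N\times 2P$ matrices with entries in $\{0,1\}$, with row local ancestry tallies $A_{n\cdot}=\sum_{p=1}^{2P}A_{np}$ and, for $p\in[P]$, ancestry-specific allele dosages $\Phi_{p,0}=\sum_{n=1}^N[(1-A_{np})X_{np}+(1-A_{n(P+p)})X_{n(P+p)}]$, $\Phi_{p,1}=\sum_{n=1}^N[A_{np}X_{np}+A_{n(P+p)}X_{n(P+p)}]$. $\mathscr{A}_{12}$ is the set of admixed arrays with $A_{n\cdot}=a_{n\cdot}$ for all $n$ and $\Phi_{p,0}=\phi_{p,0}$, $\Phi_{p,1}=\phi_{p,1}$ for all $p$. The feasible set is $\mathscr{S}=\{[\mathbf{v}_1,\mathbf{v}_2]\in(\{0,\ldots,N\})^{2P}:\mathbf{v}_1+\mathbf{v}_2\geq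 \boldsymbol{\phi}_1,\ 2N\mathbf{1}-(\mathbf{v}_1+\mathbf{v}_2)\geq \boldsymbol{\phi}_0\}$ (coordinatewise inequalities, $\mathbf{v}_1,\mathbf{v}_2\in\{0,\ldots,N\}^P$). For $\mathbf{s}_1=(s_{11},\ldots,s_{1P})$, $\mathbf{s}_2=(s_{21},\ldots,s_{2P})$, $\mathscr{A}(\mathbf{s}_1,\mathbf{s}_2,\boldsymbol{a})$ is the set of $N\times 2P$ binary matrices whose $p$th column sum is $s_{1p}$ and $(P+p)$th column sum is $s_{2p}$ for $p\in[P]$, and whose $n$th row sum is $a_{n\cdot}$ for $n\in[N]$. Binomial coefficients $\binom{n}{k}$ are $0$ when $k<0$ or $k>n$. -}

module Defs where

open import Data.Bool using (Bool; true; false; _∧_; not)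
open import Data.Nat using (ℕ; zero; suc; _+_; _*_; _∸_)
open import Data.Nat.Combinatorics using (_C_)
open import Data.Integer as ℤ using (ℤ; +_; -[1+_])
import Data.Fin
import Data.Nat
open import Data.Fin using (Fin; toℕ; _↑ˡ_; _↑ʳ_)
open import Data.Vec as Vec using (Vec; []; _∷_; lookup)
open import Data.List as List using (List; []; _∷_; length; filterᵇ; concatMap; map; allFin)
open import Data.Product using (_×_; _,_)
open import Relation.Nullary.Decidable using (⌊_⌋)

ΣFin : (n : ℕ) → (Fin n → ℕ) → ℕ
ΣFin zero f = 0
ΣFin (suc n) f = f Data.Fin.zero + ΣFin n (λ i → f (Data.Fin.suc i))


ΠFin : (n : ℕ) → (Fin n → ℕ) → ℕ
ΠFin zero f = 1
ΠFin (suc n) f = f Data.Fin.zero * ΠFin n (λ i → f (Data.Fin.suc i))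

∀Fin : (n : ℕ) → (Fin n → Bool) → Bool
∀Fin zero f = true
∀Fin (suc n) f = f Data.Fin.zero ∧ ∀Fin n (λ i → f (Data.Fin.suc i))

allVecs : {X : Set} → List X → (n : ℕ) → List (Vec X n)
allVecs xs zero = [] ∷ []
allVecs xs (suc n) = concatMap (λ x → map (x ∷_) (allVecs xs n)) xs

Mat : ℕ → ℕ → Set
Mat N M = Vec (Vec Bool M) N

entry : {N M : ℕ} → Mat N M → Fin N → Fin M → Bool
entry A n j = lookup (lookup A n) j

bit : Bool → ℕ
bit true = 1
bit false = 0

allMats : (N M : ℕ) → List (Mat N M)
allMats N M = allVecs (allVecs (true ∷ false ∷ []) M) N

count : {X : Set} → (X → Bool) → List X → ℕ
count p xs = length (filterᵇ p xs)

_==ℤ_ : ℤ → ℤ → Bool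
x ==ℤ y = ⌊ x ℤ.≟ y ⌋

_≤ℤ_ : ℤ → ℤ → Bool
x ≤ℤ y = ⌊ x ℤ.≤? y ⌋

-- binomial coefficient with integer lower index; 0 if k < 0 or k > n
binomℤ : ℕ → ℤ → ℕ
binomℤ n (+ k) = n C k
binomℤ n -[1+ k ] = 0

-- columns p and P+p of a matrix with 2P columns, p ∈ [P]
colL : (P : ℕ) → Fin P → Fin (P + P)
colL P p = p ↑ˡ P

colR : (P : ℕ) → Fin P → Fin (P + P)
colR P p = P ↑ʳ p

rowSum : {N M : ℕ} → Mat N M → Fin N → ℕ
rowSum {M = M} A n = ΣFin M (λ j → bit (entry A n j))

colSum : {N M : ℕ} → Mat N M → Fin M → ℕ
colSum {N = N} A j = ΣFin N (λ n → bit (entry A n j))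

Φ₀ : (N P : ℕ) → Mat N (P + P) → Mat N (P + P) → Fin P → ℕ
Φ₀ N P A X p = ΣFin N (λ n →
  (1 ∸ bit (entry A n (colL P p))) * bit (entry X n (colL P p))
  + (1 ∸ bit (entry A n (colR P p))) * bit (entry X n (colR P p)))

Φ₁ : (N P : ℕ) → Mat N (P + P) → Mat N (P + P) → Fin P → ℕ
Φ₁ N P A X p = ΣFin N (λ n →
  bit (entry A n (colL P p)) * bit (entry X n (colL P p))
  + bit (entry A n (colR P p)) * bit (entry X n (colR P p)))

isInA₁₂ : (N P : ℕ) → (Fin N → ℤ) → (Fin P → ℤ) → (Fin P → ℤ)
        → Mat N (P + P) × Mat N (P + P) → Bool
isInA₁₂ N P a φ₀ φ₁ (A , X) =
  ∀Fin N (λ n → (+ rowSum A n) ==ℤ a n)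
  ∧ ∀Fin P (λ p → ((+ Φ₀ N P A X p) ==ℤ φ₀ p) ∧ ((+ Φ₁ N P A X p) ==ℤ φ₁ p))

allPairs : {X Y : Set} → List X → List Y → List (X × Y)
allPairs xs ys = concatMap (λ x → map (x ,_) ys) xs

card𝒜₁₂ : (N P : ℕ) → (Fin N → ℤ) → (Fin P → ℤ) → (Fin P → ℤ) → ℕ
card𝒜₁₂ N P a φ₀ φ₁ =
  count (isInA₁₂ N P a φ₀ φ₁) (allPairs (allMats N (P + P)) (allMats N (P + P)))

card𝒜 : (N P : ℕ) → (Fin P → ℕ) → (Fin P → ℕ) → (Fin N → ℤ) → ℕ
card𝒜 N P s₁ s₂ a = count (λ M →
    ∀Fin P (λ p → ⌊ colSum M (colL P p) Data.Nat.≟ s₁ p ⌋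
                 ∧ ⌊ colSum M (colR P p) Data.Nat.≟ s₂ p ⌋)
    ∧ ∀Fin N (λ n → (+ rowSum M n) ==ℤ a n))
  (allMats N (P + P))

allBoundedVecs : (N P : ℕ) → List (Fin P → ℕ)
allBoundedVecs N P = map (λ v p → toℕ (lookup v p)) (allVecs (allFin (suc N)) P)

isFeasible : (N P : ℕ) → (Fin P → ℤ) → (Fin P → ℤ) → (Fin P → ℕ) × (Fin P → ℕ) → Bool
isFeasible N P φ₀ φ₁ (v₁ , v₂) = ∀Fin P (λ p →
  (φ₁ p ≤ℤ (+ (v₁ p + v₂ p))) ∧ (φ₀ p ≤ℤ (+ (2 * N ∸ (v₁ p + v₂ p)))))

𝒮 : (N P : ℕ) → (Fin P → ℤ) → (Fin P → ℤ) → List ((Fin P → ℕ) × (Fin P → ℕ))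
𝒮 N P φ₀ φ₁ = filterᵇ (isFeasible N P φ₀ φ₁) (allPairs (allBoundedVecs N P) (allBoundedVecs N P))

{-# OPTIONS --safe #-}
module Submission where

-- Fix the ancestry matrix A and let s₁, s₂ be its column sums. The 2N cells of the column
-- pair (p, P + p) split into the s₁ₚ + s₂ₚ cells where A is 1 and the 2N − (s₁ₚ + s₂ₚ) cells
-- where A is 0, and Φ_{p,1}, Φ_{p,0} count the ones of X in these two groups. Hence the
-- number of X with the prescribed dosages is ∏ₚ C(s₁ₚ + s₂ₚ, φ_{p,1}) C(2N − s₁ₚ − s₂ₚ, φ_{p,0});
-- this is proved by induction on the rows, a new row acting on each binomial through
-- Pascal's rule. Summing over the A with row tallies a, grouped by their column
-- sums, gives the right-hand side, where the pairs outside 𝒮 may be added or dropped freely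
-- because one of their binomial coefficients vanishes.

open import Defs
open import Data.Bool using (Bool; true; false; _∧_)
open import Data.Nat using (ℕ; zero; suc; _+_; _*_; _∸_; _≤_; _<_; _≟_; s≤s)
open import Data.Nat.Properties
  using (+-comm; +-suc; +-identityʳ; *-zeroʳ; *-assoc; *-comm; *-distribˡ-+; m+n∸n≡m;
         m+n≤o⇒n≤o; [m*n]*[o*p]≡[m*o]*[n*p]; ≤-reflexive; ≰⇒>; suc-injective;
         +-commutativeSemigroup; *-commutativeSemigroup)
open import Algebra.Properties.CommutativeSemigroup +-commutativeSemigroup
  using () renaming (interchange to +-interchange)
open import Algebra.Properties.CommutativeSemigroup *-commutativeSemigroup
  using (x∙yz≈y∙xz; xy∙z≈y∙xz)
open import Data.Nat.Combinatorics using (_C_; nCk+nC[k+1]≡[n+1]C[k+1])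
open import Data.Nat.Combinatorics.Specification using (k>n⇒nCk≡0)
open import Data.Nat.ListAction using (sum)
open import Data.Nat.ListAction.Properties using (sum-++)
open import Data.Nat.Tactic.RingSolver using (solve-∀)
open import Data.Integer as ℤ using (ℤ; -[1+_])
import Data.Integer.Properties as ℤP
import Data.Integer.Tactic.RingSolver as ℤ-Solver
open import Data.Fin as Fin using (Fin; toℕ; _↑ˡ_; _↑ʳ_)
open import Data.List using (List; []; _∷_; map; _++_; concatMap; filterᵇ; allFin)
open import Data.List.Properties using (map-++; map-cong; map-∘; map-tabulate)
open import Data.Vec as Vec using (Vec; []; _∷_; lookup)
open import Data.Vec.Properties using (lookup-++ˡ; lookup-++ʳ)
open import Data.Product using (_×_; _,_; proj₁; proj₂)
open import Function using (_∘_; _⇔_; mk⇔)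
open import Relation.Binary.PropositionalEquality
open import Relation.Nullary.Decidable using (Dec; ⌊_⌋; yes; no; does-⇔; isYes≗does)
open ≡-Reasoning

-- Finite sums and products over enumerations

private
  variable
    X Y : Set

∑ : List X → (X → ℕ) → ℕ
∑ xs f = sum (map f xs)

syntax ∑ xs (λ x → e) = ∑[ x ∈ xs ] e

∑-cong : (xs : List X) {f g : X → ℕ} → (∀ x → f x ≡ g x) → ∑ xs f ≡ ∑ xs g
∑-cong xs f≗g = cong sum (map-cong f≗g xs)

∑-map : (xs : List X) (h : X → Y) (f : Y → ℕ) → ∑ (map h xs) f ≡ ∑ xs (f ∘ h)
∑-map xs h f = cong sum (sym (map-∘ xs))

∑-++ : (xs ys : List X) (f : X → ℕ) → ∑ (xs ++ ys) f ≡ ∑ xs f + ∑ ys f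
∑-++ xs ys f = trans (cong sum (map-++ f xs ys)) (sum-++ (map f xs) (map f ys))

∑-concatMap : (xs : List X) (g : X → List Y) (f : Y → ℕ) →
              ∑ (concatMap g xs) f ≡ ∑[ x ∈ xs ] ∑ (g x) f
∑-concatMap []       g f = refl
∑-concatMap (x ∷ xs) g f =
  trans (∑-++ (g x) (concatMap g xs) f) (cong (∑ (g x) f +_) (∑-concatMap xs g f))

∑-zero : (xs : List X) → ∑[ x ∈ xs ] 0 ≡ 0
∑-zero []       = refl
∑-zero (x ∷ xs) = ∑-zero xs

∑-+ : (xs : List X) (f g : X → ℕ) → ∑[ x ∈ xs ] (f x + g x) ≡ ∑ xs f + ∑ xs g
∑-+ []       f g = refl
∑-+ (x ∷ xs) f g = begin
  f x + g x + ∑[ x ∈ xs ] (f x + g x) ≡⟨ cong (f x + g x +_) (∑-+ xs f g) ⟩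
  f x + g x + (∑ xs f + ∑ xs g)       ≡⟨ +-interchange (f x) (g x) (∑ xs f) (∑ xs g) ⟩
  f x + ∑ xs f + (g x + ∑ xs g)       ∎

∑-*ˡ : (xs : List X) (c : ℕ) (f : X → ℕ) → ∑[ x ∈ xs ] (c * f x) ≡ c * ∑ xs f
∑-*ˡ []       c f = sym (*-zeroʳ c)
∑-*ˡ (x ∷ xs) c f =
  trans (cong (c * f x +_) (∑-*ˡ xs c f)) (sym (*-distribˡ-+ c (f x) (∑ xs f)))

∑-*ʳ : (xs : List X) (c : ℕ) (f : X → ℕ) → ∑[ x ∈ xs ] (f x * c) ≡ ∑ xs f * c
∑-*ʳ xs c f = begin
  ∑[ x ∈ xs ] (f x * c) ≡⟨ ∑-cong xs (λ x → *-comm (f x) c) ⟩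
  ∑[ x ∈ xs ] (c * f x) ≡⟨ ∑-*ˡ xs c f ⟩
  c * ∑ xs f            ≡⟨ *-comm c (∑ xs f) ⟩
  ∑ xs f * c            ∎

∑-comm : (xs : List X) (ys : List Y) (f : X → Y → ℕ) →
         ∑[ x ∈ xs ] ∑[ y ∈ ys ] f x y ≡ ∑[ y ∈ ys ] ∑[ x ∈ xs ] f x y
∑-comm []       ys f = sym (∑-zero ys)
∑-comm (x ∷ xs) ys f =
  trans (cong (∑ ys (f x) +_) (∑-comm xs ys f)) (sym (∑-+ ys (f x) _))

count≡∑ : (p : X → Bool) (xs : List X) → count p xs ≡ ∑[ x ∈ xs ] bit (p x)
count≡∑ p []       = refl
count≡∑ p (x ∷ xs) with p x
... | true  = cong suc (count≡∑ p xs)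
... | false = count≡∑ p xs

∑-filterᵇ-redundant : (p : X → Bool) (f : X → ℕ) (xs : List X) →
                      (∀ x → bit (p x) * f x ≡ f x) → ∑ (filterᵇ p xs) f ≡ ∑ xs f
∑-filterᵇ-redundant p f []       _ = refl
∑-filterᵇ-redundant p f (x ∷ xs) h with p x | h x
... | true  | _    = cong (f x +_) (∑-filterᵇ-redundant p f xs h)
... | false | 0≡fx = trans (∑-filterᵇ-redundant p f xs h) (cong (_+ ∑ xs f) 0≡fx)

∑-allPairs : (xs : List X) (ys : List Y) (f : X × Y → ℕ) →
             ∑ (allPairs xs ys) f ≡ ∑[ x ∈ xs ] ∑[ y ∈ ys ] f (x , y)
∑-allPairs xs ys f =
  trans (∑-concatMap xs _ f) (∑-cong xs (λ x → ∑-map ys (x ,_) f))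

∑-allVecs-suc : (xs : List X) (n : ℕ) (f : Vec X (suc n) → ℕ) →
                ∑ (allVecs xs (suc n)) f ≡ ∑[ x ∈ xs ] ∑[ v ∈ allVecs xs n ] f (x ∷ v)
∑-allVecs-suc xs n f =
  trans (∑-concatMap xs _ f) (∑-cong xs (λ x → ∑-map (allVecs xs n) (x ∷_) f))

∑-allVecs-++ : (xs : List X) (m n : ℕ) (f : Vec X (m + n) → ℕ) →
               ∑ (allVecs xs (m + n)) f
                 ≡ ∑[ u ∈ allVecs xs m ] ∑[ w ∈ allVecs xs n ] f (u Vec.++ w)
∑-allVecs-++ xs zero    n f = sym (+-identityʳ _)
∑-allVecs-++ xs (suc m) n f = begin
  ∑ (allVecs xs (suc (m + n))) f
    ≡⟨ ∑-allVecs-suc xs (m + n) f ⟩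
  ∑[ x ∈ xs ] ∑[ v ∈ allVecs xs (m + n) ] f (x ∷ v)
    ≡⟨ ∑-cong xs (λ x → ∑-allVecs-++ xs m n (f ∘ (x ∷_))) ⟩
  ∑[ x ∈ xs ] ∑[ u ∈ allVecs xs m ] ∑[ w ∈ allVecs xs n ] f (x ∷ u Vec.++ w)
    ≡⟨ ∑-allVecs-suc xs m _ ⟨
  ∑[ u ∈ allVecs xs (suc m) ] ∑[ w ∈ allVecs xs n ] f (u Vec.++ w)
    ∎

ΠFin-cong : (n : ℕ) {f g : Fin n → ℕ} → (∀ i → f i ≡ g i) → ΠFin n f ≡ ΠFin n g
ΠFin-cong zero    _   = refl
ΠFin-cong (suc n) f≗g = cong₂ _*_ (f≗g Fin.zero) (ΠFin-cong n (f≗g ∘ Fin.suc))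

ΠFin-* : (n : ℕ) (f g : Fin n → ℕ) → ΠFin n f * ΠFin n g ≡ ΠFin n (λ i → f i * g i)
ΠFin-* zero    f g = refl
ΠFin-* (suc n) f g = begin
  f₀ * Πf * (g₀ * Πg) ≡⟨ [m*n]*[o*p]≡[m*o]*[n*p] f₀ Πf g₀ Πg ⟩
  f₀ * g₀ * (Πf * Πg) ≡⟨ cong (f₀ * g₀ *_) (ΠFin-* n (f ∘ Fin.suc) (g ∘ Fin.suc)) ⟩
  f₀ * g₀ * ΠFin n (λ i → f (Fin.suc i) * g (Fin.suc i)) ∎
  where
  f₀ = f Fin.zero
  g₀ = g Fin.zero
  Πf = ΠFin n (f ∘ Fin.suc)
  Πg = ΠFin n (g ∘ Fin.suc)

∀Fin-cong : (n : ℕ) {f g : Fin n → Bool} → (∀ i → f i ≡ g i) → ∀Fin n f ≡ ∀Fin n g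
∀Fin-cong zero    _   = refl
∀Fin-cong (suc n) f≗g = cong₂ _∧_ (f≗g Fin.zero) (∀Fin-cong n (f≗g ∘ Fin.suc))

bit-∧ : (x y : Bool) → bit (x ∧ y) ≡ bit x * bit y
bit-∧ true  y = sym (+-identityʳ (bit y))
bit-∧ false y = refl

bit-∀Fin : (n : ℕ) (b : Fin n → Bool) → bit (∀Fin n b) ≡ ΠFin n (bit ∘ b)
bit-∀Fin zero    b = refl
bit-∀Fin (suc n) b =
  trans (bit-∧ (b Fin.zero) _) (cong (bit (b Fin.zero) *_) (bit-∀Fin n (b ∘ Fin.suc)))

bit-∀Fin-*-ΠFin : (n : ℕ) (b : Fin n → Bool) (f : Fin n → ℕ) →
                  bit (∀Fin n b) * ΠFin n f ≡ ΠFin n (λ i → bit (b i) * f i)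
bit-∀Fin-*-ΠFin n b f = trans (cong (_* ΠFin n f) (bit-∀Fin n b)) (ΠFin-* n (bit ∘ b) f)

∑-allVecs-ΠFin : (xs : List X) (n : ℕ) (f : Fin n → X → ℕ) →
                 ∑[ v ∈ allVecs xs n ] ΠFin n (λ i → f i (lookup v i))
                   ≡ ΠFin n (λ i → ∑ xs (f i))
∑-allVecs-ΠFin xs zero    f = refl
∑-allVecs-ΠFin xs (suc n) f = begin
  ∑[ v ∈ allVecs xs (suc n) ] ΠFin (suc n) (λ i → f i (lookup v i))
    ≡⟨ ∑-allVecs-suc xs n _ ⟩
  ∑[ x ∈ xs ] ∑[ v ∈ allVecs xs n ] (f Fin.zero x * Πtail v)
    ≡⟨ ∑-cong xs (λ x → ∑-*ˡ (allVecs xs n) (f Fin.zero x) Πtail) ⟩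
  ∑[ x ∈ xs ] (f Fin.zero x * ∑ (allVecs xs n) Πtail)
    ≡⟨ ∑-*ʳ xs _ (f Fin.zero) ⟩
  ∑ xs (f Fin.zero) * ∑ (allVecs xs n) Πtail
    ≡⟨ cong (∑ xs (f Fin.zero) *_) (∑-allVecs-ΠFin xs n (f ∘ Fin.suc)) ⟩
  ΠFin (suc n) (λ i → ∑ xs (f i))
    ∎
  where
  Πtail : Vec _ n → ℕ
  Πtail v = ΠFin n (λ i → f (Fin.suc i) (lookup v i))

∑-allVecs²-ΠFin : (xs : List X) (ys : List Y) (n : ℕ) (f : Fin n → X → Y → ℕ) →
                  ∑[ u ∈ allVecs xs n ] ∑[ w ∈ allVecs ys n ]
                    ΠFin n (λ i → f i (lookup u i) (lookup w i))
                  ≡ ΠFin n (λ i → ∑[ x ∈ xs ] ∑[ y ∈ ys ] f i x y)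
∑-allVecs²-ΠFin xs ys n f = begin
  ∑[ u ∈ allVecs xs n ] ∑[ w ∈ allVecs ys n ] ΠFin n (λ i → f i (lookup u i) (lookup w i))
    ≡⟨ ∑-cong (allVecs xs n) (λ u → ∑-allVecs-ΠFin ys n (λ i → f i (lookup u i))) ⟩
  ∑[ u ∈ allVecs xs n ] ΠFin n (λ i → ∑ ys (f i (lookup u i)))
    ≡⟨ ∑-allVecs-ΠFin xs n (λ i x → ∑ ys (f i x)) ⟩
  ΠFin n (λ i → ∑[ x ∈ xs ] ∑ ys (f i x))
    ∎

∑-allVecs-halves-ΠFin : (xs : List X) (n : ℕ) (f : Fin n → X → X → ℕ) →
                        ∑[ r ∈ allVecs xs (n + n) ]
                          ΠFin n (λ i → f i (lookup r (i ↑ˡ n)) (lookup r (n ↑ʳ i)))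
                        ≡ ΠFin n (λ i → ∑[ x ∈ xs ] ∑[ y ∈ xs ] f i x y)
∑-allVecs-halves-ΠFin xs n f = begin
  ∑[ r ∈ allVecs xs (n + n) ] ΠFin n (λ i → f i (lookup r (i ↑ˡ n)) (lookup r (n ↑ʳ i)))
    ≡⟨ ∑-allVecs-++ xs n n _ ⟩
  ∑[ u ∈ allVecs xs n ] ∑[ w ∈ allVecs xs n ]
    ΠFin n (λ i → f i (lookup (u Vec.++ w) (i ↑ˡ n)) (lookup (u Vec.++ w) (n ↑ʳ i)))
    ≡⟨ ∑-cong (allVecs xs n) (λ u → ∑-cong (allVecs xs n) (λ w → ΠFin-cong n (λ i →
         cong₂ (f i) (lookup-++ˡ u w i) (lookup-++ʳ u w i)))) ⟩
  ∑[ u ∈ allVecs xs n ] ∑[ w ∈ allVecs xs n ] ΠFin n (λ i → f i (lookup u i) (lookup w i))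
    ≡⟨ ∑-allVecs²-ΠFin xs xs n f ⟩
  ΠFin n (λ i → ∑[ x ∈ xs ] ∑[ y ∈ xs ] f i x y)
    ∎

⌊⌋-⇔ : {A B : Set} → A ⇔ B → (a? : Dec A) (b? : Dec B) → ⌊ a? ⌋ ≡ ⌊ b? ⌋
⌊⌋-⇔ A⇔B a? b? = trans (isYes≗does a?) (trans (does-⇔ A⇔B a? b?) (sym (isYes≗does b?)))

∑-allFin-suc : (n : ℕ) (f : Fin (suc n) → ℕ) →
               ∑ (allFin (suc n)) f ≡ f Fin.zero + ∑[ i ∈ allFin n ] f (Fin.suc i)
∑-allFin-suc n f = cong (f Fin.zero +_)
  (trans (cong (λ is → ∑ is f) (sym (map-tabulate (λ i → i) Fin.suc))) (∑-map (allFin n) Fin.suc f))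

∑-allFin-indicator : (n c : ℕ) (f : ℕ → ℕ) → c < n →
                     ∑[ i ∈ allFin n ] (bit ⌊ c ≟ toℕ i ⌋ * f (toℕ i)) ≡ f c
∑-allFin-indicator (suc n) zero f _ = begin
  ∑[ i ∈ allFin (suc n) ] (bit ⌊ 0 ≟ toℕ i ⌋ * f (toℕ i))
    ≡⟨ ∑-allFin-suc n _ ⟩
  f 0 + 0 + ∑[ i ∈ allFin n ] 0
    ≡⟨ cong₂ _+_ (+-identityʳ (f 0)) (∑-zero (allFin n)) ⟩
  f 0 + 0
    ≡⟨ +-identityʳ (f 0) ⟩
  f 0
    ∎
∑-allFin-indicator (suc n) (suc c) f (s≤s c<n) = begin
  ∑[ i ∈ allFin (suc n) ] (bit ⌊ suc c ≟ toℕ i ⌋ * f (toℕ i))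
    ≡⟨ ∑-allFin-suc n (λ i → bit ⌊ suc c ≟ toℕ i ⌋ * f (toℕ i)) ⟩
  ∑[ i ∈ allFin n ] (bit ⌊ suc c ≟ suc (toℕ i) ⌋ * f (suc (toℕ i)))
    ≡⟨ ∑-cong (allFin n) (λ i → cong (λ b → bit b * f (suc (toℕ i)))
         (⌊⌋-⇔ (mk⇔ suc-injective (cong suc)) (suc c ≟ suc (toℕ i)) (c ≟ toℕ i))) ⟩
  ∑[ i ∈ allFin n ] (bit ⌊ c ≟ toℕ i ⌋ * f (suc (toℕ i)))
    ≡⟨ ∑-allFin-indicator n c (f ∘ suc) c<n ⟩
  f (suc c)
    ∎

∑-allFin²-indicator : (n c d : ℕ) (f : ℕ → ℕ → ℕ) → c < n → d < n →
                      ∑[ i ∈ allFin n ] ∑[ j ∈ allFin n ]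
                        (bit (⌊ c ≟ toℕ i ⌋ ∧ ⌊ d ≟ toℕ j ⌋) * f (toℕ i) (toℕ j))
                      ≡ f c d
∑-allFin²-indicator n c d f c<n d<n = begin
  ∑[ i ∈ allFin n ] ∑[ j ∈ allFin n ] (bit (c≟ i ∧ d≟ j) * f (toℕ i) (toℕ j))
    ≡⟨ ∑-cong (allFin n) (λ i → ∑-cong (allFin n) (λ j →
         trans (cong (_* f (toℕ i) (toℕ j)) (bit-∧ (c≟ i) (d≟ j))) (*-assoc (bit (c≟ i)) _ _))) ⟩
  ∑[ i ∈ allFin n ] ∑[ j ∈ allFin n ] (bit (c≟ i) * (bit (d≟ j) * f (toℕ i) (toℕ j)))
    ≡⟨ ∑-cong (allFin n) (λ i → ∑-*ˡ (allFin n) (bit (c≟ i)) _) ⟩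
  ∑[ i ∈ allFin n ] (bit (c≟ i) * ∑[ j ∈ allFin n ] (bit (d≟ j) * f (toℕ i) (toℕ j)))
    ≡⟨ ∑-cong (allFin n) (λ i → cong (bit (c≟ i) *_) (∑-allFin-indicator n d (f (toℕ i)) d<n)) ⟩
  ∑[ i ∈ allFin n ] (bit (c≟ i) * f (toℕ i) d)
    ≡⟨ ∑-allFin-indicator n c (λ x → f x d) c<n ⟩
  f c d
    ∎
  where
  c≟ d≟ : Fin n → Bool
  c≟ i = ⌊ c ≟ toℕ i ⌋
  d≟ j = ⌊ d ≟ toℕ j ⌋

-- Binomial coefficients with an integer lower index

binomℤ-suc : (n : ℕ) (φ : ℤ) → binomℤ (suc n) φ ≡ binomℤ n φ + binomℤ n (φ ℤ.- ℤ.+ 1)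
binomℤ-suc n -[1+ k ]      = refl
binomℤ-suc n (ℤ.+ zero)    = refl
binomℤ-suc n (ℤ.+ (suc k)) = trans (sym (nCk+nC[k+1]≡[n+1]C[k+1] n k)) (+-comm (n C k) _)

binomℤ-zero : (φ : ℤ) → bit ((ℤ.+ 0) ==ℤ φ) ≡ binomℤ 0 φ
binomℤ-zero (ℤ.+ zero)    = refl
binomℤ-zero (ℤ.+ (suc k)) = refl
binomℤ-zero -[1+ k ]      = refl

bit-≤ℤ-*-binomℤ : (n : ℕ) (φ : ℤ) → bit (φ ≤ℤ (ℤ.+ n)) * binomℤ n φ ≡ binomℤ n φ
bit-≤ℤ-*-binomℤ n φ with φ ℤ.≤? ℤ.+ n
... | yes _ = +-identityʳ (binomℤ n φ)
bit-≤ℤ-*-binomℤ n -[1+ k ] | no _   = refl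
bit-≤ℤ-*-binomℤ n (ℤ.+ k)  | no k≰n = sym (k>n⇒nCk≡0 (≰⇒> (k≰n ∘ ℤ.+≤+)))

==ℤ-shift : (c y φ : ℤ) → ((c ℤ.+ y) ==ℤ φ) ≡ (y ==ℤ (φ ℤ.- c))
==ℤ-shift c y φ = ⌊⌋-⇔ (mk⇔ to from) ((c ℤ.+ y) ℤ.≟ φ) (y ℤ.≟ (φ ℤ.- c))
  where
  cancel₁ : ∀ c y → y ≡ (c ℤ.+ y) ℤ.- c
  cancel₁ = ℤ-Solver.solve-∀
  cancel₂ : ∀ c φ → c ℤ.+ (φ ℤ.- c) ≡ φ
  cancel₂ = ℤ-Solver.solve-∀
  to : c ℤ.+ y ≡ φ → y ≡ φ ℤ.- c
  to c+y≡φ = trans (cancel₁ c y) (cong (ℤ._- c) c+y≡φ)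
  from : y ≡ φ ℤ.- c → c ℤ.+ y ≡ φ
  from y≡φ-c = trans (cong (λ z → c ℤ.+ z) y≡φ-c) (cancel₂ c φ)

i-[j+k]≡[i-j]-k : (φ a b : ℤ) → φ ℤ.- (a ℤ.+ b) ≡ (φ ℤ.- a) ℤ.- b
i-[j+k]≡[i-j]-k = ℤ-Solver.solve-∀

bits : List Bool
bits = true ∷ false ∷ []

dose₁ dose₀ : Bool → Bool → ℕ
dose₁ α x = bit α * bit x
dose₀ α x = (1 ∸ bit α) * bit x

pascal-cell : (α : Bool) (K₁ K₀ : ℕ) (φ₁ φ₀ : ℤ) →
              ∑[ x ∈ bits ] (binomℤ K₁ (φ₁ ℤ.- ℤ.+ dose₁ α x) * binomℤ K₀ (φ₀ ℤ.- ℤ.+ dose₀ α x))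
              ≡ binomℤ (bit α + K₁) φ₁ * binomℤ ((1 ∸ bit α) + K₀) φ₀
pascal-cell true K₁ K₀ φ₁ φ₀ = begin
  B₁ (φ₁ ℤ.- ℤ.+ 1) * B₀ (φ₀ ℤ.- ℤ.+ 0) + (B₁ (φ₁ ℤ.- ℤ.+ 0) * B₀ (φ₀ ℤ.- ℤ.+ 0) + 0)
    ≡⟨ cong₂ (λ u v → B₁ (φ₁ ℤ.- ℤ.+ 1) * B₀ v + (B₁ u * B₀ v + 0)) (ℤP.+-identityʳ φ₁) (ℤP.+-identityʳ φ₀) ⟩
  B₁ (φ₁ ℤ.- ℤ.+ 1) * B₀ φ₀ + (B₁ φ₁ * B₀ φ₀ + 0)
    ≡⟨ collect (B₁ φ₁) (B₁ (φ₁ ℤ.- ℤ.+ 1)) (B₀ φ₀) ⟩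
  (B₁ φ₁ + B₁ (φ₁ ℤ.- ℤ.+ 1)) * B₀ φ₀
    ≡⟨ cong (_* B₀ φ₀) (binomℤ-suc K₁ φ₁) ⟨
  binomℤ (suc K₁) φ₁ * B₀ φ₀
    ∎
  where
  B₁ B₀ : ℤ → ℕ
  B₁ = binomℤ K₁
  B₀ = binomℤ K₀
  collect : ∀ a a′ b → a′ * b + (a * b + 0) ≡ (a + a′) * b
  collect = solve-∀
pascal-cell false K₁ K₀ φ₁ φ₀ = begin
  B₁ (φ₁ ℤ.- ℤ.+ 0) * B₀ (φ₀ ℤ.- ℤ.+ 1) + (B₁ (φ₁ ℤ.- ℤ.+ 0) * B₀ (φ₀ ℤ.- ℤ.+ 0) + 0)
    ≡⟨ cong₂ (λ u v → B₁ u * B₀ (φ₀ ℤ.- ℤ.+ 1) + (B₁ u * B₀ v + 0)) (ℤP.+-identityʳ φ₁) (ℤP.+-identityʳ φ₀) ⟩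
  B₁ φ₁ * B₀ (φ₀ ℤ.- ℤ.+ 1) + (B₁ φ₁ * B₀ φ₀ + 0)
    ≡⟨ collect (B₁ φ₁) (B₀ φ₀) (B₀ (φ₀ ℤ.- ℤ.+ 1)) ⟩
  B₁ φ₁ * (B₀ φ₀ + B₀ (φ₀ ℤ.- ℤ.+ 1))
    ≡⟨ cong (B₁ φ₁ *_) (binomℤ-suc K₀ φ₀) ⟨
  B₁ φ₁ * binomℤ (suc K₀) φ₀
    ∎
  where
  B₁ B₀ : ℤ → ℕ
  B₁ = binomℤ K₁
  B₀ = binomℤ K₀
  collect : ∀ a b b′ → a * b′ + (a * b + 0) ≡ a * (b + b′)
  collect = solve-∀

pascal-locus : (αL αR : Bool) (cL cR zL zR : ℕ) (φ₁ φ₀ : ℤ) →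
               ∑[ x ∈ bits ] ∑[ y ∈ bits ]
                 (binomℤ (cL + cR) (φ₁ ℤ.- ℤ.+ (dose₁ αL x + dose₁ αR y))
                  * binomℤ (zL + zR) (φ₀ ℤ.- ℤ.+ (dose₀ αL x + dose₀ αR y)))
               ≡ binomℤ ((bit αL + cL) + (bit αR + cR)) φ₁
                 * binomℤ (((1 ∸ bit αL) + zL) + ((1 ∸ bit αR) + zR)) φ₀
pascal-locus αL αR cL cR zL zR φ₁ φ₀ = begin
  ∑[ x ∈ bits ] ∑[ y ∈ bits ]
    (binomℤ (cL + cR) (φ₁ ℤ.- ℤ.+ (dose₁ αL x + dose₁ αR y))
     * binomℤ (zL + zR) (φ₀ ℤ.- ℤ.+ (dose₀ αL x + dose₀ αR y)))
    ≡⟨ ∑-cong bits (λ x → ∑-cong bits (λ y → cong₂ (λ u v → binomℤ (cL + cR) u * binomℤ (zL + zR) v)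
         (i-[j+k]≡[i-j]-k φ₁ (ℤ.+ dose₁ αL x) (ℤ.+ dose₁ αR y)) (i-[j+k]≡[i-j]-k φ₀ (ℤ.+ dose₀ αL x) (ℤ.+ dose₀ αR y)))) ⟩
  ∑[ x ∈ bits ] ∑[ y ∈ bits ]
    (binomℤ (cL + cR) ((φ₁ ℤ.- ℤ.+ dose₁ αL x) ℤ.- ℤ.+ dose₁ αR y)
     * binomℤ (zL + zR) ((φ₀ ℤ.- ℤ.+ dose₀ αL x) ℤ.- ℤ.+ dose₀ αR y))
    ≡⟨ ∑-cong bits (λ x → pascal-cell αR (cL + cR) (zL + zR) (φ₁ ℤ.- ℤ.+ dose₁ αL x) (φ₀ ℤ.- ℤ.+ dose₀ αL x)) ⟩
  ∑[ x ∈ bits ]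
    (binomℤ (bit αR + (cL + cR)) (φ₁ ℤ.- ℤ.+ dose₁ αL x)
     * binomℤ ((1 ∸ bit αR) + (zL + zR)) (φ₀ ℤ.- ℤ.+ dose₀ αL x))
    ≡⟨ pascal-cell αL _ _ φ₁ φ₀ ⟩
  binomℤ (bit αL + (bit αR + (cL + cR))) φ₁ * binomℤ ((1 ∸ bit αL) + ((1 ∸ bit αR) + (zL + zR))) φ₀
    ≡⟨ cong₂ (λ u v → binomℤ u φ₁ * binomℤ v φ₀) (regroup (bit αL) (bit αR) cL cR) (regroup (1 ∸ bit αL) (1 ∸ bit αR) zL zR) ⟩
  binomℤ ((bit αL + cL) + (bit αR + cR)) φ₁ * binomℤ (((1 ∸ bit αL) + zL) + ((1 ∸ bit αR) + zR)) φ₀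
    ∎
  where
  regroup : ∀ a b c d → a + (b + (c + d)) ≡ (a + c) + (b + d)
  regroup = solve-∀

-- Allele matrices with prescribed dosages

dosagesMatch : (N P : ℕ) → Mat N (P + P) → Mat N (P + P) → (Fin P → ℤ) → (Fin P → ℤ) → Bool
dosagesMatch N P A X φ₀ φ₁ =
  ∀Fin P (λ p → ((ℤ.+ Φ₀ N P A X p) ==ℤ φ₀ p) ∧ ((ℤ.+ Φ₁ N P A X p) ==ℤ φ₁ p))

rowDose₁ rowDose₀ : (P : ℕ) → Vec Bool (P + P) → Vec Bool (P + P) → Fin P → ℕ
rowDose₁ P α r p = dose₁ (lookup α (colL P p)) (lookup r (colL P p))
                 + dose₁ (lookup α (colR P p)) (lookup r (colR P p))
rowDose₀ P α r p = dose₀ (lookup α (colL P p)) (lookup r (colL P p))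
                 + dose₀ (lookup α (colR P p)) (lookup r (colR P p))

dosagesMatch-∷ : (N P : ℕ) (α r : Vec Bool (P + P)) (A X : Mat N (P + P)) (φ₀ φ₁ : Fin P → ℤ) →
                 dosagesMatch (suc N) P (α ∷ A) (r ∷ X) φ₀ φ₁
                 ≡ dosagesMatch N P A X (λ p → φ₀ p ℤ.- ℤ.+ rowDose₀ P α r p)
                                        (λ p → φ₁ p ℤ.- ℤ.+ rowDose₁ P α r p)
dosagesMatch-∷ N P α r A X φ₀ φ₁ = ∀Fin-cong P (λ p → cong₂ _∧_
  (==ℤ-shift (ℤ.+ rowDose₀ P α r p) (ℤ.+ Φ₀ N P A X p) (φ₀ p))
  (==ℤ-shift (ℤ.+ rowDose₁ P α r p) (ℤ.+ Φ₁ N P A X p) (φ₁ p)))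

-- Counting the zeros of A directly keeps truncated subtraction out of the row induction.
colZeros : {N M : ℕ} → Mat N M → Fin M → ℕ
colZeros {N = N} A j = ΣFin N (λ n → 1 ∸ bit (entry A n j))

locusOnes locusZeros : {N : ℕ} (P : ℕ) → Mat N (P + P) → Fin P → ℕ
locusOnes  P A p = colSum A (colL P p) + colSum A (colR P p)
locusZeros P A p = colZeros A (colL P p) + colZeros A (colR P p)

countDosages : (N P : ℕ) (A : Mat N (P + P)) (φ₀ φ₁ : Fin P → ℤ) →
               ∑[ X ∈ allMats N (P + P) ] bit (dosagesMatch N P A X φ₀ φ₁)
               ≡ ΠFin P (λ p → binomℤ (locusOnes P A p) (φ₁ p) * binomℤ (locusZeros P A p) (φ₀ p))
countDosages zero P [] φ₀ φ₁ = begin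
  bit (dosagesMatch 0 P [] [] φ₀ φ₁) + 0
    ≡⟨ +-identityʳ _ ⟩
  bit (dosagesMatch 0 P [] [] φ₀ φ₁)
    ≡⟨ bit-∀Fin P _ ⟩
  ΠFin P (λ p → bit (((ℤ.+ 0) ==ℤ φ₀ p) ∧ ((ℤ.+ 0) ==ℤ φ₁ p)))
    ≡⟨ ΠFin-cong P (λ p → begin
         bit (((ℤ.+ 0) ==ℤ φ₀ p) ∧ ((ℤ.+ 0) ==ℤ φ₁ p))  ≡⟨ bit-∧ ((ℤ.+ 0) ==ℤ φ₀ p) _ ⟩
         bit ((ℤ.+ 0) ==ℤ φ₀ p) * bit ((ℤ.+ 0) ==ℤ φ₁ p) ≡⟨ cong₂ _*_ (binomℤ-zero (φ₀ p)) (binomℤ-zero (φ₁ p)) ⟩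
         binomℤ 0 (φ₀ p) * binomℤ 0 (φ₁ p)                ≡⟨ *-comm (binomℤ 0 (φ₀ p)) _ ⟩
         binomℤ 0 (φ₁ p) * binomℤ 0 (φ₀ p)                ∎) ⟩
  ΠFin P (λ p → binomℤ 0 (φ₁ p) * binomℤ 0 (φ₀ p))
    ∎
countDosages (suc N) P (α ∷ A) φ₀ φ₁ = begin
  ∑[ X ∈ allMats (suc N) (P + P) ] bit (dosagesMatch (suc N) P (α ∷ A) X φ₀ φ₁)
    ≡⟨ ∑-allVecs-suc rows N _ ⟩
  ∑[ r ∈ rows ] ∑[ X ∈ allMats N (P + P) ] bit (dosagesMatch (suc N) P (α ∷ A) (r ∷ X) φ₀ φ₁)
    ≡⟨ ∑-cong rows (λ r → ∑-cong (allMats N (P + P)) (λ X → cong bit (dosagesMatch-∷ N P α r A X φ₀ φ₁))) ⟩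
  ∑[ r ∈ rows ] ∑[ X ∈ allMats N (P + P) ] bit (dosagesMatch N P A X (φ₀′ r) (φ₁′ r))
    ≡⟨ ∑-cong rows (λ r → countDosages N P A (φ₀′ r) (φ₁′ r)) ⟩
  ∑[ r ∈ rows ] ΠFin P (λ p → g p (lookup r (colL P p)) (lookup r (colR P p)))
    ≡⟨ ∑-allVecs-halves-ΠFin bits P g ⟩
  ΠFin P (λ p → ∑[ x ∈ bits ] ∑[ y ∈ bits ] g p x y)
    ≡⟨ ΠFin-cong P (λ p → pascal-locus (αL p) (αR p) (colSum A (colL P p)) (colSum A (colR P p))
         (colZeros A (colL P p)) (colZeros A (colR P p)) (φ₁ p) (φ₀ p)) ⟩
  ΠFin P (λ p → binomℤ (locusOnes P (α ∷ A) p) (φ₁ p) * binomℤ (locusZeros P (α ∷ A) p) (φ₀ p))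
    ∎
  where
  rows : List (Vec Bool (P + P))
  rows = allVecs bits (P + P)
  φ₀′ φ₁′ : Vec Bool (P + P) → Fin P → ℤ
  φ₀′ r p = φ₀ p ℤ.- ℤ.+ rowDose₀ P α r p
  φ₁′ r p = φ₁ p ℤ.- ℤ.+ rowDose₁ P α r p
  αL αR : Fin P → Bool
  αL p = lookup α (colL P p)
  αR p = lookup α (colR P p)
  g : Fin P → Bool → Bool → ℕ
  g p x y = binomℤ (locusOnes P A p) (φ₁ p ℤ.- ℤ.+ (dose₁ (αL p) x + dose₁ (αR p) y))
          * binomℤ (locusZeros P A p) (φ₀ p ℤ.- ℤ.+ (dose₀ (αL p) x + dose₀ (αR p) y))

colZeros+colSum : {N M : ℕ} (A : Mat N M) (j : Fin M) → colZeros A j + colSum A j ≡ N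
colZeros+colSum []      j = refl
colZeros+colSum (r ∷ A) j with lookup r j
... | true  = trans (+-suc (colZeros A j) (colSum A j)) (cong suc (colZeros+colSum A j))
... | false = cong suc (colZeros+colSum A j)

locusZeros≡2N∸locusOnes : (N P : ℕ) (A : Mat N (P + P)) (p : Fin P) →
                         locusZeros P A p ≡ 2 * N ∸ locusOnes P A p
locusZeros≡2N∸locusOnes N P A p = begin
  zL + zR                                 ≡⟨ m+n∸n≡m (zL + zR) (cL + cR) ⟨
  (zL + zR) + (cL + cR) ∸ (cL + cR)       ≡⟨ cong (_∸ (cL + cR)) (regroup zL zR cL cR) ⟩
  (zL + cL) + ((zR + cR) + 0) ∸ (cL + cR) ≡⟨ cong₂ (λ u v → u + (v + 0) ∸ (cL + cR))
                                               (colZeros+colSum A (colL P p)) (colZeros+colSum A (colR P p)) ⟩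
  2 * N ∸ (cL + cR)                       ∎
  where
  zL = colZeros A (colL P p)
  zR = colZeros A (colR P p)
  cL = colSum A (colL P p)
  cR = colSum A (colR P p)
  regroup : ∀ a b c d → (a + b) + (c + d) ≡ (a + c) + ((b + d) + 0)
  regroup = solve-∀

locusWeight : ℕ → ℤ → ℤ → ℕ → ℕ → ℕ
locusWeight N φ₀ φ₁ x y = binomℤ (x + y) φ₁ * binomℤ (2 * N ∸ (x + y)) φ₀

weight : (N P : ℕ) → (Fin P → ℤ) → (Fin P → ℤ) → (Fin P → ℕ) → (Fin P → ℕ) → ℕ
weight N P φ₀ φ₁ s₁ s₂ = ΠFin P (λ p → locusWeight N (φ₀ p) (φ₁ p) (s₁ p) (s₂ p))

countDosages≡weight : (N P : ℕ) (A : Mat N (P + P)) (φ₀ φ₁ : Fin P → ℤ) →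
                      ∑[ X ∈ allMats N (P + P) ] bit (dosagesMatch N P A X φ₀ φ₁)
                      ≡ weight N P φ₀ φ₁ (colSum A ∘ colL P) (colSum A ∘ colR P)
countDosages≡weight N P A φ₀ φ₁ = trans (countDosages N P A φ₀ φ₁)
  (ΠFin-cong P (λ p → cong (λ z → binomℤ (locusOnes P A p) (φ₁ p) * binomℤ z (φ₀ p))
                           (locusZeros≡2N∸locusOnes N P A p)))

-- Grouping ancestry matrices by column sums

tallyMatch : (N P : ℕ) → (Fin N → ℤ) → Mat N (P + P) → Bool
tallyMatch N P a A = ∀Fin N (λ n → (ℤ.+ rowSum A n) ==ℤ a n)

colMatch : {N : ℕ} (P : ℕ) → Mat N (P + P) → (Fin P → ℕ) → (Fin P → ℕ) → Bool
colMatch P A s₁ s₂ = ∀Fin P (λ p → ⌊ colSum A (colL P p) ≟ s₁ p ⌋ ∧ ⌊ colSum A (colR P p) ≟ s₂ p ⌋)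

colSum≤ : {N M : ℕ} (A : Mat N M) (j : Fin M) → colSum A j ≤ N
colSum≤ A j = m+n≤o⇒n≤o (colZeros A j) (≤-reflexive (colZeros+colSum A j))

∑-allBoundedVecs²-indicator :
  (N P : ℕ) (c₁ c₂ : Fin P → ℕ) (h : Fin P → ℕ → ℕ → ℕ) → (∀ p → c₁ p ≤ N) → (∀ p → c₂ p ≤ N) →
  ∑[ s₁ ∈ allBoundedVecs N P ] ∑[ s₂ ∈ allBoundedVecs N P ]
    (bit (∀Fin P (λ p → ⌊ c₁ p ≟ s₁ p ⌋ ∧ ⌊ c₂ p ≟ s₂ p ⌋)) * ΠFin P (λ p → h p (s₁ p) (s₂ p)))
  ≡ ΠFin P (λ p → h p (c₁ p) (c₂ p))
∑-allBoundedVecs²-indicator N P c₁ c₂ h c₁≤N c₂≤N = begin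
  ∑[ s₁ ∈ allBoundedVecs N P ] ∑[ s₂ ∈ allBoundedVecs N P ] term s₁ s₂
    ≡⟨ trans (∑-map V toℕs _) (∑-cong V (λ u → ∑-map V toℕs _)) ⟩
  ∑[ u ∈ V ] ∑[ w ∈ V ] term (toℕs u) (toℕs w)
    ≡⟨ ∑-cong V (λ u → ∑-cong V (λ w → bit-∀Fin-*-ΠFin P _ _)) ⟩
  ∑[ u ∈ V ] ∑[ w ∈ V ] ΠFin P (λ p → g p (lookup u p) (lookup w p))
    ≡⟨ ∑-allVecs²-ΠFin (allFin (suc N)) (allFin (suc N)) P g ⟩
  ΠFin P (λ p → ∑[ i ∈ allFin (suc N) ] ∑[ j ∈ allFin (suc N) ] g p i j)
    ≡⟨ ΠFin-cong P (λ p → ∑-allFin²-indicator (suc N) (c₁ p) (c₂ p) (h p) (s≤s (c₁≤N p)) (s≤s (c₂≤N p))) ⟩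
  ΠFin P (λ p → h p (c₁ p) (c₂ p))
    ∎
  where
  V = allVecs (allFin (suc N)) P
  toℕs : Vec (Fin (suc N)) P → Fin P → ℕ
  toℕs v p = toℕ (lookup v p)
  term : (Fin P → ℕ) → (Fin P → ℕ) → ℕ
  term s₁ s₂ = bit (∀Fin P (λ p → ⌊ c₁ p ≟ s₁ p ⌋ ∧ ⌊ c₂ p ≟ s₂ p ⌋)) * ΠFin P (λ p → h p (s₁ p) (s₂ p))
  g : Fin P → Fin (suc N) → Fin (suc N) → ℕ
  g p i j = bit (⌊ c₁ p ≟ toℕ i ⌋ ∧ ⌊ c₂ p ≟ toℕ j ⌋) * h p (toℕ i) (toℕ j)

isFeasible-*-weight : (N P : ℕ) (φ₀ φ₁ : Fin P → ℤ) (s₁ s₂ : Fin P → ℕ) →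
                      bit (isFeasible N P φ₀ φ₁ (s₁ , s₂)) * weight N P φ₀ φ₁ s₁ s₂ ≡ weight N P φ₀ φ₁ s₁ s₂
isFeasible-*-weight N P φ₀ φ₁ s₁ s₂ = trans (bit-∀Fin-*-ΠFin P _ _) (ΠFin-cong P (λ p →
  let n = s₁ p + s₂ p ; m = 2 * N ∸ (s₁ p + s₂ p)
      u = φ₁ p ≤ℤ (ℤ.+ n) ; v = φ₀ p ≤ℤ (ℤ.+ m) in
  begin
    bit (u ∧ v) * (binomℤ n (φ₁ p) * binomℤ m (φ₀ p))
      ≡⟨ cong (_* (binomℤ n (φ₁ p) * binomℤ m (φ₀ p))) (bit-∧ u v) ⟩
    bit u * bit v * (binomℤ n (φ₁ p) * binomℤ m (φ₀ p))
      ≡⟨ [m*n]*[o*p]≡[m*o]*[n*p] (bit u) (bit v) (binomℤ n (φ₁ p)) (binomℤ m (φ₀ p)) ⟩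
    bit u * binomℤ n (φ₁ p) * (bit v * binomℤ m (φ₀ p))
      ≡⟨ cong₂ _*_ (bit-≤ℤ-*-binomℤ n (φ₁ p)) (bit-≤ℤ-*-binomℤ m (φ₀ p)) ⟩
    binomℤ n (φ₁ p) * binomℤ m (φ₀ p)
      ∎))

card𝒜-*≡∑ : (N P : ℕ) (s₁ s₂ : Fin P → ℕ) (a : Fin N → ℤ) (w : ℕ) →
            card𝒜 N P s₁ s₂ a * w
            ≡ ∑[ A ∈ allMats N (P + P) ] (bit (tallyMatch N P a A) * (bit (colMatch P A s₁ s₂) * w))
card𝒜-*≡∑ N P s₁ s₂ a w = begin
  card𝒜 N P s₁ s₂ a * w
    ≡⟨ cong (_* w) (count≡∑ _ (allMats N (P + P))) ⟩
  ∑[ A ∈ allMats N (P + P) ] bit (colMatch P A s₁ s₂ ∧ tallyMatch N P a A) * w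
    ≡⟨ ∑-*ʳ (allMats N (P + P)) w _ ⟨
  ∑[ A ∈ allMats N (P + P) ] (bit (colMatch P A s₁ s₂ ∧ tallyMatch N P a A) * w)
    ≡⟨ ∑-cong (allMats N (P + P)) (λ A → begin
         bit (colMatch P A s₁ s₂ ∧ tallyMatch N P a A) * w
           ≡⟨ cong (_* w) (bit-∧ (colMatch P A s₁ s₂) (tallyMatch N P a A)) ⟩
         bit (colMatch P A s₁ s₂) * bit (tallyMatch N P a A) * w
           ≡⟨ xy∙z≈y∙xz (bit (colMatch P A s₁ s₂)) (bit (tallyMatch N P a A)) w ⟩
         bit (tallyMatch N P a A) * (bit (colMatch P A s₁ s₂) * w)
           ∎) ⟩
  ∑[ A ∈ allMats N (P + P) ] (bit (tallyMatch N P a A) * (bit (colMatch P A s₁ s₂) * w))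
    ∎

∑-𝒮≡∑-tallyMatch :
  (N P : ℕ) (a : Fin N → ℤ) (φ₀ φ₁ : Fin P → ℤ) →
  ∑[ s ∈ 𝒮 N P φ₀ φ₁ ] (card𝒜 N P (proj₁ s) (proj₂ s) a * weight N P φ₀ φ₁ (proj₁ s) (proj₂ s))
  ≡ ∑[ A ∈ allMats N (P + P) ]
      (bit (tallyMatch N P a A) * weight N P φ₀ φ₁ (colSum A ∘ colL P) (colSum A ∘ colR P))
∑-𝒮≡∑-tallyMatch N P a φ₀ φ₁ = begin
  ∑ (filterᵇ (isFeasible N P φ₀ φ₁) (allPairs BV BV)) G
    ≡⟨ ∑-filterᵇ-redundant (isFeasible N P φ₀ φ₁) G (allPairs BV BV) feasible-or-zero ⟩
  ∑ (allPairs BV BV) G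
    ≡⟨ ∑-allPairs BV BV G ⟩
  ∑[ s₁ ∈ BV ] ∑[ s₂ ∈ BV ] (card𝒜 N P s₁ s₂ a * w s₁ s₂)
    ≡⟨ ∑-cong BV (λ s₁ → ∑-cong BV (λ s₂ → card𝒜-*≡∑ N P s₁ s₂ a (w s₁ s₂))) ⟩
  ∑[ s₁ ∈ BV ] ∑[ s₂ ∈ BV ] ∑[ A ∈ Ms ] (tally A * cols A s₁ s₂)
    ≡⟨ trans (∑-cong BV (λ s₁ → ∑-comm BV Ms (λ s₂ A → tally A * cols A s₁ s₂)))
             (∑-comm BV Ms (λ s₁ A → ∑[ s₂ ∈ BV ] (tally A * cols A s₁ s₂))) ⟩
  ∑[ A ∈ Ms ] ∑[ s₁ ∈ BV ] ∑[ s₂ ∈ BV ] (tally A * cols A s₁ s₂)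
    ≡⟨ ∑-cong Ms (λ A → trans (∑-cong BV (λ s₁ → ∑-*ˡ BV (tally A) (cols A s₁)))
                              (∑-*ˡ BV (tally A) (λ s₁ → ∑ BV (cols A s₁)))) ⟩
  ∑[ A ∈ Ms ] (tally A * ∑[ s₁ ∈ BV ] ∑[ s₂ ∈ BV ] cols A s₁ s₂)
    ≡⟨ ∑-cong Ms (λ A → cong (tally A *_) (∑-allBoundedVecs²-indicator N P
         (colSum A ∘ colL P) (colSum A ∘ colR P) (λ p → locusWeight N (φ₀ p) (φ₁ p))
         (colSum≤ A ∘ colL P) (colSum≤ A ∘ colR P))) ⟩
  ∑[ A ∈ Ms ] (bit (tallyMatch N P a A) * w (colSum A ∘ colL P) (colSum A ∘ colR P))
    ∎
  where
  BV = allBoundedVecs N P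
  Ms = allMats N (P + P)
  w : (Fin P → ℕ) → (Fin P → ℕ) → ℕ
  w = weight N P φ₀ φ₁
  tally : Mat N (P + P) → ℕ
  tally A = bit (tallyMatch N P a A)
  cols : Mat N (P + P) → (Fin P → ℕ) → (Fin P → ℕ) → ℕ
  cols A s₁ s₂ = bit (colMatch P A s₁ s₂) * w s₁ s₂
  G : (Fin P → ℕ) × (Fin P → ℕ) → ℕ
  G (s₁ , s₂) = card𝒜 N P s₁ s₂ a * w s₁ s₂
  feasible-or-zero : ∀ s → bit (isFeasible N P φ₀ φ₁ s) * G s ≡ G s
  feasible-or-zero (s₁ , s₂) = begin
    bit (isFeasible N P φ₀ φ₁ (s₁ , s₂)) * (card𝒜 N P s₁ s₂ a * w s₁ s₂)
      ≡⟨ x∙yz≈y∙xz (bit (isFeasible N P φ₀ φ₁ (s₁ , s₂))) (card𝒜 N P s₁ s₂ a) (w s₁ s₂) ⟩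
    card𝒜 N P s₁ s₂ a * (bit (isFeasible N P φ₀ φ₁ (s₁ , s₂)) * w s₁ s₂)
      ≡⟨ cong (card𝒜 N P s₁ s₂ a *_) (isFeasible-*-weight N P φ₀ φ₁ s₁ s₂) ⟩
    card𝒜 N P s₁ s₂ a * w s₁ s₂
      ∎

card𝒜₁₂≡∑-tallyMatch : (N P : ℕ) (a : Fin N → ℤ) (φ₀ φ₁ : Fin P → ℤ) →
                        card𝒜₁₂ N P a φ₀ φ₁
                        ≡ ∑[ A ∈ allMats N (P + P) ]
                            (bit (tallyMatch N P a A) * ∑[ X ∈ allMats N (P + P) ] bit (dosagesMatch N P A X φ₀ φ₁))
card𝒜₁₂≡∑-tallyMatch N P a φ₀ φ₁ = begin
  card𝒜₁₂ N P a φ₀ φ₁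
    ≡⟨ count≡∑ (isInA₁₂ N P a φ₀ φ₁) (allPairs Ms Ms) ⟩
  ∑[ AX ∈ allPairs Ms Ms ] bit (isInA₁₂ N P a φ₀ φ₁ AX)
    ≡⟨ ∑-allPairs Ms Ms _ ⟩
  ∑[ A ∈ Ms ] ∑[ X ∈ Ms ] bit (tallyMatch N P a A ∧ dosagesMatch N P A X φ₀ φ₁)
    ≡⟨ ∑-cong Ms (λ A → trans (∑-cong Ms (λ X → bit-∧ (tallyMatch N P a A) _))
                              (∑-*ˡ Ms (bit (tallyMatch N P a A)) (λ X → bit (dosagesMatch N P A X φ₀ φ₁)))) ⟩
  ∑[ A ∈ Ms ] (bit (tallyMatch N P a A) * ∑[ X ∈ Ms ] bit (dosagesMatch N P A X φ₀ φ₁))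
    ∎
  where
  Ms = allMats N (P + P)

proposition4 : (N P : ℕ) → 1 ≤ N → 1 ≤ P
    → (a : Fin N → ℤ) → (φ₀ φ₁ : Fin P → ℤ)
    → card𝒜₁₂ N P a φ₀ φ₁
      ≡ sum (map (λ { (s₁ , s₂) → card𝒜 N P s₁ s₂ a
                    * ΠFin P (λ p → binomℤ (s₁ p + s₂ p) (φ₁ p)
                                   * binomℤ (2 * N ∸ (s₁ p + s₂ p)) (φ₀ p)) })
                 (𝒮 N P φ₀ φ₁))
proposition4 N P _ _ a φ₀ φ₁ = begin
  card𝒜₁₂ N P a φ₀ φ₁
    ≡⟨ card𝒜₁₂≡∑-tallyMatch N P a φ₀ φ₁ ⟩
  ∑[ A ∈ Ms ] (bit (tallyMatch N P a A) * ∑[ X ∈ Ms ] bit (dosagesMatch N P A X φ₀ φ₁))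
    ≡⟨ ∑-cong Ms (λ A → cong (bit (tallyMatch N P a A) *_) (countDosages≡weight N P A φ₀ φ₁)) ⟩
  ∑[ A ∈ Ms ] (bit (tallyMatch N P a A) * weight N P φ₀ φ₁ (colSum A ∘ colL P) (colSum A ∘ colR P))
    ≡⟨ ∑-𝒮≡∑-tallyMatch N P a φ₀ φ₁ ⟨
  ∑[ s ∈ 𝒮 N P φ₀ φ₁ ] (card𝒜 N P (proj₁ s) (proj₂ s) a * weight N P φ₀ φ₁ (proj₁ s) (proj₂ s))
    ∎
  where
  Ms = allMats N (P + P)
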